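{- Let $(D,\sqsubseteq)$ be a partial ordering, let $F$ be a set of prop rules on $D$, and let $r=b\to g$ be a prop rule with witness $w$ for $b$. Suppose $e$ is the least common fixpoint of the rules in $F$ among the elements $\sqsupseteq w$. If $g(e)=e$, then $r$ is redundant with respect to $F$, i.e., the set of common fixpoints of $F$ equals the set of common fixpoints of $F\cup\{r\}$.
   Context: A function $f:D\to D$ is stable if for all $d,e\in D$, $f(d)\sqsubseteq e$ implies $f(e)=e$. A condition $b$ is a predicate on $D$; "$b$ holds in $d$" means it evaluates to true at $d$. $b$ is monotonic if $b$ holding in $d$ and $d\sqsubseteq e$ imply $b$ holds in $e$; $b$ is precise if there is a least element $d$ in which $b$ holds, called the witness of $b$. A rule $b\to g$ consists of a condition $b$ and a function $g:D\to D$ (its body) and acts on $D$ by $(b\to g)(d)=g(d)$ if $b$ holds in $d$, and $(b\to g)(d)=d$ otherwise. A prop rule is a rule $b\to g$ with $b$ monotonic and precise and $g$ stable. A fixpoint of a set of functions means a common fixpoint of all of them. -}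

module Defs where

open import Level using (Level; _⊔_; suc)
open import Data.Bool using (Bool; true; false; if_then_else_)
open import Data.Product using (Σ; _×_; _,_)
open import Data.Sum using (_⊎_)
open import Relation.Binary.PropositionalEquality using (_≡_)
open import Relation.Binary.Core using (Rel)

record Rule {a : Level} (D : Set a) : Set a where
  constructor _⇒_
  field
    cond : D → Bool
    body : D → D
open Rule public

apply : ∀ {a} {D : Set a} → Rule D → D → D
apply r d = if cond r d then body r d else d

Holds : ∀ {a} {D : Set a} → (D → Bool) → D → Set
Holds b d = b d ≡ true

module _ {a ℓ : Level} {D : Set a} (_⊑_ : Rel D ℓ) where

  Stable : (D → D) → Set (a ⊔ ℓ)
  Stable f = ∀ d e → f d ⊑ e → f e ≡ e

  Monotonic : (D → Bool) → Set (a ⊔ ℓ)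
  Monotonic b = ∀ d e → Holds b d → d ⊑ e → Holds b e

  IsWitness : (D → Bool) → D → Set (a ⊔ ℓ)
  IsWitness b w = Holds b w × (∀ d → Holds b d → w ⊑ d)

  Precise : (D → Bool) → Set (a ⊔ ℓ)
  Precise b = Σ D (λ w → IsWitness b w)

  IsPropRule : Rule D → Set (a ⊔ ℓ)
  IsPropRule r = Monotonic (cond r) × Precise (cond r) × Stable (body r)

IsFixpointOf : ∀ {a p} {D : Set a} → (Rule D → Set p) → D → Set (a ⊔ p)
IsFixpointOf F d = ∀ r → F r → apply r d ≡ d

_∪｛_｝ : ∀ {a p} {D : Set a} → (Rule D → Set p) → Rule D → (Rule D → Set (a ⊔ p))
(F ∪｛ r ｝) s = F s ⊎ s ≡ r

module Submission where

open import Defs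
open import Level using (Level)
open import Data.Bool using (true; false)
open import Data.Product using (_,_)
open import Data.Sum using (inj₁; inj₂)
open import Relation.Binary.Core using (Rel)
open import Relation.Binary.Structures using (IsPartialOrder)
open import Relation.Binary.PropositionalEquality using (_≡_; refl; subst; sym)
open import Function.Bundles using (_⇔_; mk⇔)

-- If r fixes every common fixpoint d of F, then it is redundant. The condition of r can only
-- fire at such a d above its witness w; minimality of e then gives g(e) = e ⊑ d, and stability
-- of g turns this into g(d) = d.

stable-fixes-above-fixpoint : ∀ {a ℓ} {D : Set a} (_⊑_ : Rel D ℓ) {g : D → D} {e d : D} →
  Stable _⊑_ g → g e ≡ e → e ⊑ d → g d ≡ d
stable-fixes-above-fixpoint _⊑_ {e = e} {d} stable ge≡e e⊑d =
  stable e d (subst (_⊑ d) (sym ge≡e) e⊑d)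

apply-fixes-if-body-fixes : ∀ {a} {D : Set a} (r : Rule D) d →
  (Holds (cond r) d → body r d ≡ d) → apply r d ≡ d
apply-fixes-if-body-fixes r d body-fixes with cond r d | body-fixes
... | true  | fixes = fixes refl
... | false | _     = refl

redundant-if-fixes-fixpoints : ∀ {a p} {D : Set a} (F : Rule D → Set p) (r : Rule D) →
  (∀ d → IsFixpointOf F d → apply r d ≡ d) →
  ∀ d → IsFixpointOf F d ⇔ IsFixpointOf (F ∪｛ r ｝) d
redundant-if-fixes-fixpoints F r r-fixes d = mk⇔ extend (λ fix s Fs → fix s (inj₁ Fs))
  where
  extend : IsFixpointOf F d → IsFixpointOf (F ∪｛ r ｝) d
  extend fix s (inj₁ Fs)   = fix s Fs
  extend fix s (inj₂ refl) = r-fixes d fix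

theorem5 : ∀ {a ℓ p : Level} {D : Set a} (_⊑_ : Rel D ℓ) → IsPartialOrder _≡_ _⊑_ →
    (F : Rule D → Set p) → (∀ s → F s → IsPropRule _⊑_ s) →
    (r : Rule D) → IsPropRule _⊑_ r →
    (w : D) → IsWitness _⊑_ (cond r) w →
    (e : D) → (w ⊑ e) → IsFixpointOf F e → (∀ d → w ⊑ d → IsFixpointOf F d → e ⊑ d) →
    body r e ≡ e →
    ∀ d → IsFixpointOf F d ⇔ IsFixpointOf (F ∪｛ r ｝) d
theorem5 _⊑_ _ F _ r (_ , _ , stable) w (_ , w-least) e _ _ e-least ge≡e =
  redundant-if-fixes-fixpoints F r λ d fix →
    apply-fixes-if-body-fixes r d λ holds →
      stable-fixes-above-fixpoint _⊑_ stable ge≡e (e-least d (w-least d holds) fix)
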